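{- For all integers $h \ge 2$ and $k \ge 3$, we have $hk \in \mathcal{R}_{\mathbf{Z}}(h,k)$.
   Context: For a nonempty set $A$ of integers and a positive integer $h$, $hA$ denotes the set of all sums of $h$ not necessarily distinct elements of $A$. The sumset size set is $\mathcal{R}_{\mathbf{Z}}(h,k) = \{ |hA| : A \subseteq \mathbf{Z},\ |A| = k \}$. -}

module Defs where

open import Data.Nat using (ℕ)
open import Data.Integer using (ℤ; _+_; 0ℤ)
open import Data.List using (List; length; foldr)
open import Data.List.Relation.Unary.All using (All)
open import Data.List.Relation.Unary.Unique.Propositional using (Unique)
open import Data.List.Membership.Propositional using (_∈_)
open import Data.Product using (Σ; _×_)
open import Function.Bundles using (_⇔_)
open import Relation.Binary.PropositionalEquality using (_≡_)

sumℤ : List ℤ → ℤ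
sumℤ = foldr _+_ 0ℤ

-- Finite sets of integers are represented by duplicate-free lists.
-- `IsSetOfSize A k` : the list A has no repetitions and exactly k elements.
IsSetOfSize : List ℤ → ℕ → Set
IsSetOfSize A k = Unique A × (length A ≡ k)

InSumset : ℕ → List ℤ → ℤ → Set
InSumset h A x =
  Σ (List ℤ) λ xs → (length xs ≡ h) × All (_∈ A) xs × (sumℤ xs ≡ x)

SumsetSize : ℕ → List ℤ → ℕ → Set
SumsetSize h A m =
  Σ (List ℤ) λ S → Unique S × (length S ≡ m) × (∀ x → (x ∈ S) ⇔ InSumset h A x)

InRZ : ℕ → ℕ → ℕ → Set
InRZ h k m = Σ (List ℤ) λ A → IsSetOfSize A k × SumsetSize h A m

{-# OPTIONS --safe #-}
module Submission where

-- Take A = {0, 1, …, k − 2, k}, the interval [0, k] with its penultimate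
-- point removed. Then hA is [0, hk] with hk − 1 removed, a set of hk
-- elements. A sum of h elements of A is at most hk and misses hk − 1,
-- because reaching it would need a summand k − 1. Conversely, v ≤ hk − 2 is
-- written greedily: summands k while v ≥ k, then v itself if v ≤ k − 2,
-- and k − 1 = (k − 2) + 1 otherwise. That last case needs 1 ∈ A (so k ≥ 3)
-- and a second summand, which exists because v ≤ hk − 2 forces h ≥ 2.

open import Defs
open import Data.Nat using (ℕ; zero; suc; pred; _+_; _*_; _∸_; _≤_; _<_; z≤n; s≤s; _≤?_)
open import Data.Nat.Properties
open import Data.Nat.ListAction using (sum)
open import Data.Integer as ℤ using (ℤ; +_)
open import Data.Integer.Properties using (+-injective)
open import Data.List using (List; []; _∷_; map; length; upTo)
open import Data.List.Properties using (length-map; length-upTo)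
open import Data.List.Relation.Unary.All as All using (All; []; _∷_)
import Data.List.Relation.Unary.All.Properties as All
open import Data.List.Relation.Unary.AllPairs using (_∷_)
open import Data.List.Relation.Unary.Any using (here; there)
open import Data.List.Relation.Unary.Unique.Propositional using (Unique)
import Data.List.Relation.Unary.Unique.Propositional.Properties as Unique
open import Data.List.Membership.Propositional using (_∈_)
open import Data.List.Membership.Propositional.Properties using (∈-map⁺; ∈-map⁻; ∈-upTo⁺; ∈-upTo⁻)
open import Data.Product using (Σ; _×_; _,_)
open import Data.Sum using (_⊎_; inj₁; inj₂)
open import Function.Bundles using (_⇔_; mk⇔; module Equivalence)
open import Relation.Nullary using (yes; no; contradiction)
open import Relation.Binary.PropositionalEquality using (_≡_; _≢_; refl; sym; trans; cong; subst)

Punctured : ℕ → ℕ → Set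
Punctured n v = 2 + v ≤ n ⊎ v ≡ n

punctured : ℕ → List ℕ
punctured n = n ∷ upTo (pred n)

InSumsetℕ : ℕ → (ℕ → Set) → ℕ → Set
InSumsetℕ h P v = Σ (List ℕ) λ ns → length ns ≡ h × All P ns × sum ns ≡ v

module _ {P : ℕ → Set} where

  InSumsetℕ-∷ : ∀ {h a v} → P a → InSumsetℕ h P v → InSumsetℕ (suc h) P (a + v)
  InSumsetℕ-∷ pa (ns , refl , ps , refl) = _ ∷ ns , refl , pa ∷ ps , refl

  InSumsetℕ-zero : P 0 → ∀ h → InSumsetℕ h P 0
  InSumsetℕ-zero p0 zero    = [] , refl , [] , refl
  InSumsetℕ-zero p0 (suc h) = InSumsetℕ-∷ p0 (InSumsetℕ-zero p0 h)

  InSumsetℕ-mono : ∀ {Q : ℕ → Set} {h v} → (∀ {x} → P x → Q x) → InSumsetℕ h P v → InSumsetℕ h Q v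
  InSumsetℕ-mono P⇒Q (ns , len , ps , s) = ns , len , All.map P⇒Q ps , s

Punctured⇒≤ : ∀ {n v} → Punctured n v → v ≤ n
Punctured⇒≤ (inj₁ 2+v≤n) = m+n≤o⇒n≤o 2 2+v≤n
Punctured⇒≤ (inj₂ refl)   = ≤-refl

Punctured-< : ∀ {n v} → v < n → Punctured n v → 2 + v ≤ n
Punctured-< _   (inj₁ 2+v≤n) = 2+v≤n
Punctured-< v<n (inj₂ refl)   = contradiction v<n (n≮n _)

Punctured-+ : ∀ {m n a b} → Punctured m a → Punctured n b → Punctured (m + n) (a + b)
Punctured-+ (inj₁ 2+a≤m) pb = inj₁ (+-mono-≤ 2+a≤m (Punctured⇒≤ pb))
Punctured-+ {m} {n} {b = b} (inj₂ refl) (inj₁ 2+b≤n) = inj₁ (begin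
  2 + (m + b)   ≡⟨ trans (+-suc m (suc b)) (cong suc (+-suc m b)) ⟨
  m + (2 + b)   ≤⟨ +-monoʳ-≤ m 2+b≤n ⟩
  m + n         ∎)
  where open ≤-Reasoning
Punctured-+ (inj₂ refl) (inj₂ refl) = inj₂ refl

Punctured-∸ : ∀ {k n v} → k ≤ v → Punctured (k + n) v → Punctured n (v ∸ k)
Punctured-∸ {k} {n} {v} k≤v (inj₁ 2+v≤k+n) = inj₁ (begin
  2 + (v ∸ k)   ≡⟨ +-∸-assoc 2 k≤v ⟨
  2 + v ∸ k     ≤⟨ ∸-monoˡ-≤ k 2+v≤k+n ⟩
  k + n ∸ k     ≡⟨ m+n∸m≡n k n ⟩
  n             ∎)
  where open ≤-Reasoning
Punctured-∸ {k} {n} _ (inj₂ refl) = inj₂ (m+n∸m≡n k n)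

All-Punctured⇒sum : ∀ {k ns} → All (Punctured k) ns → Punctured (length ns * k) (sum ns)
All-Punctured⇒sum []       = inj₂ refl
All-Punctured⇒sum (p ∷ ps) = Punctured-+ p (All-Punctured⇒sum ps)

sumset-Punctured-⊆ : ∀ {k h v} → InSumsetℕ h (Punctured k) v → Punctured (h * k) v
sumset-Punctured-⊆ (_ , refl , ps , refl) = All-Punctured⇒sum ps

sumset-Punctured-penultimate : ∀ {u} h → InSumsetℕ (2 + h) (Punctured (3 + u)) (2 + u)
sumset-Punctured-penultimate {u} h =
  subst (InSumsetℕ (2 + h) (Punctured (3 + u))) (+-comm (suc u) 1)
    (InSumsetℕ-∷ (inj₁ ≤-refl)
      (InSumsetℕ-∷ (inj₁ (s≤s (s≤s (s≤s z≤n))))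
        (InSumsetℕ-zero (inj₁ (s≤s (s≤s z≤n))) h)))

sumset-Punctured-below : ∀ {k h v} → 3 ≤ k → v < k → 2 + v ≤ suc h * k →
                         InSumsetℕ (suc h) (Punctured k) v
sumset-Punctured-below {k} {h} {v} 3≤k v<k 2+v≤ with 2 + v ≤? k
... | yes 2+v≤k =
  subst (InSumsetℕ (suc h) (Punctured k)) (+-identityʳ v)
    (InSumsetℕ-∷ (inj₁ 2+v≤k) (InSumsetℕ-zero (inj₁ (≤-trans (s≤s (s≤s z≤n)) 3≤k)) h))
sumset-Punctured-below {k} {zero} {v} _ _ 2+v≤ | no 2+v≰k =
  contradiction (subst (2 + v ≤_) (+-identityʳ k) 2+v≤) 2+v≰k
sumset-Punctured-below {h = suc h} (s≤s (s≤s (s≤s _))) v<k _ | no 2+v≰k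
  with ≤-antisym v<k (≤-pred (≰⇒> 2+v≰k))
... | refl = sumset-Punctured-penultimate h

sumset-Punctured-⊇ : ∀ {k} → 3 ≤ k → ∀ h {v} → Punctured (h * k) v → InSumsetℕ h (Punctured k) v
sumset-Punctured-⊇ _ zero (inj₂ refl) = [] , refl , [] , refl
sumset-Punctured-⊇ {k} 3≤k (suc h) {v} pv with k ≤? v
... | yes k≤v =
  subst (InSumsetℕ (suc h) (Punctured k)) (m+[n∸m]≡n k≤v)
    (InSumsetℕ-∷ (inj₂ refl) (sumset-Punctured-⊇ 3≤k h (Punctured-∸ k≤v pv)))
... | no k≰v =
  sumset-Punctured-below 3≤k (≰⇒> k≰v) (Punctured-< (<-≤-trans (≰⇒> k≰v) (m≤m+n k _)) pv)

∈-punctured⁻ : ∀ {n v} → v ∈ punctured n → Punctured n v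
∈-punctured⁻ (here refl)          = inj₂ refl
∈-punctured⁻ {suc n} (there v∈) = inj₁ (s≤s (∈-upTo⁻ v∈))

∈-punctured⁺ : ∀ {n v} → Punctured n v → v ∈ punctured n
∈-punctured⁺ (inj₁ (s≤s v<n)) = there (∈-upTo⁺ v<n)
∈-punctured⁺ (inj₂ refl)       = here refl

punctured-unique : ∀ n → Unique (punctured n)
punctured-unique n = All.tabulate n∉ ∷ Unique.upTo⁺ (pred n)
  where
  n∉ : ∀ {v} → v ∈ upTo (pred n) → n ≢ v
  n∉ v∈ refl = <⇒≱ (∈-upTo⁻ v∈) pred[n]≤n

length-punctured : ∀ {n} → 0 < n → length (punctured n) ≡ n
length-punctured {suc n} _ = cong suc (length-upTo n)

sumℤ-map-+ : ∀ ns → sumℤ (map +_ ns) ≡ + sum ns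
sumℤ-map-+ []       = refl
sumℤ-map-+ (n ∷ ns) = cong (ℤ._+_ (+ n)) (sumℤ-map-+ ns)

All-∈-map⁻ : ∀ {A B : Set} {f : A → B} {L xs} → All (_∈ map f L) xs →
             Σ (List A) λ as → All (_∈ L) as × map f as ≡ xs
All-∈-map⁻ []       = [] , [] , refl
All-∈-map⁻ {f = f} (x∈ ∷ xs∈) with ∈-map⁻ f x∈ | All-∈-map⁻ xs∈
... | a , a∈ , refl | as , as∈ , refl = a ∷ as , a∈ ∷ as∈ , refl

InSumset-map-+ : ∀ {h L x} → InSumset h (map +_ L) x ⇔ Σ ℕ λ v → x ≡ + v × InSumsetℕ h (_∈ L) v
InSumset-map-+ {h} {L} {x} = mk⇔ to from
  where
  to : InSumset h (map +_ L) x → Σ ℕ λ v → x ≡ + v × InSumsetℕ h (_∈ L) v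
  to (xs , len , xs∈ , refl) with All-∈-map⁻ xs∈
  ... | ns , ns∈ , refl = sum ns , sumℤ-map-+ ns , ns , trans (sym (length-map +_ ns)) len , ns∈ , refl

  from : (Σ ℕ λ v → x ≡ + v × InSumsetℕ h (_∈ L) v) → InSumset h (map +_ L) x
  from (_ , refl , ns , len , ns∈ , refl) =
    map +_ ns , trans (length-map +_ ns) len , All.map⁺ (All.map (∈-map⁺ (+_)) ns∈) , sumℤ-map-+ ns

sumset-punctured : ∀ {k} → 3 ≤ k → ∀ h x →
                   x ∈ map +_ (punctured (h * k)) ⇔ InSumset h (map +_ (punctured k)) x
sumset-punctured {k} 3≤k h x = mk⇔ to from
  where
  to : x ∈ map +_ (punctured (h * k)) → InSumset h (map +_ (punctured k)) x
  to x∈ with ∈-map⁻ (+_) x∈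
  ... | v , v∈ , refl = Equivalence.from InSumset-map-+
    (v , refl , InSumsetℕ-mono ∈-punctured⁺ (sumset-Punctured-⊇ 3≤k h (∈-punctured⁻ v∈)))

  from : InSumset h (map +_ (punctured k)) x → x ∈ map +_ (punctured (h * k))
  from x∈hA with Equivalence.to InSumset-map-+ x∈hA
  ... | v , refl , v∈hA = ∈-map⁺ (+_) (∈-punctured⁺ (sumset-Punctured-⊆ (InSumsetℕ-mono ∈-punctured⁻ v∈hA)))

mainTheorem9 : (h k : ℕ) → 2 ≤ h → 3 ≤ k → InRZ h k (h * k)
mainTheorem9 h k 2≤h 3≤k =
  map +_ (punctured k) , (unique k , length-ℤ 0<k) ,
  map +_ (punctured (h * k)) , unique (h * k) , length-ℤ 0<hk , sumset-punctured 3≤k h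
  where
  unique : ∀ n → Unique (map +_ (punctured n))
  unique n = Unique.map⁺ +-injective (punctured-unique n)

  length-ℤ : ∀ {n} → 0 < n → length (map +_ (punctured n)) ≡ n
  length-ℤ {n} 0<n = trans (length-map +_ (punctured n)) (length-punctured 0<n)

  0<k : 0 < k
  0<k = ≤-trans (s≤s z≤n) 3≤k

  0<hk : 0 < h * k
  0<hk = ≤-trans (s≤s z≤n) (*-mono-≤ 2≤h 3≤k)
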